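{- Let $G$ and $G'$ be finite additive abelian groups, let $h\ge 2$ and $g\ge 1$ be integers, and let $\phi:G\to G'$ be a group homomorphism with $|\mathrm{Ker}(\phi)|=g_1$. If $A\in B_h[g](G)$, then $\phi(A)\in B_h[gg_1](\phi(G))$.
   Context: For an additive abelian group $G$, a subset $A\subseteq G$ and positive integers $h\ge 2$, $g$, we write $A\in B_h[g](G)$ if every $b\in G$ has at most $g$ distinct representations $b=a_1+\cdots+a_h$ with $a_1,\dots,a_h\in A$, where two representations are considered the same if the multisets $\{\{a_1,\dots,a_h\}\}$ coincide (i.e. representations are counted up to reordering of the summands). $\phi(A)=\{\phi(a):a\in A\}$. -}

module Defs where

open import Level using (0ℓ; suc)
open import Data.Nat using (ℕ) renaming (suc to sucℕ)
open import Data.Fin using (Fin)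
open import Data.Vec using (Vec; foldr; toList)
open import Data.Vec.Relation.Unary.All using (All)
open import Data.Product using (Σ; ∃; _×_; proj₁)
open import Relation.Nullary using (¬_)
open import Relation.Unary using (Pred)
open import Relation.Binary.PropositionalEquality using (_≡_)
open import Data.List.Relation.Binary.Permutation.Propositional using (_↭_)
open import Algebra.Structures using (IsAbelianGroup)
open import Function.Bundles using (_↔_)

record FinAbGroup : Set₁ where
  infixl 6 _+_
  field
    Carrier        : Set
    _+_            : Carrier → Carrier → Carrier
    0#             : Carrier
    -_             : Carrier → Carrier
    isAbelianGroup : IsAbelianGroup _≡_ _+_ 0# -_
    size           : ℕ
    enum           : Carrier ↔ Fin size

open FinAbGroup public using () renaming (Carrier to Car)

module _ (G : FinAbGroup) where
  open FinAbGroup G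

  sumV : ∀ {h} → Vec Carrier h → Carrier
  sumV = foldr (λ _ → Carrier) _+_ 0#

  Rep : (h : ℕ) → Pred Carrier 0ℓ → Carrier → Set
  Rep h A b = Σ (Vec Carrier h) λ v → All A v × sumV v ≡ b

  -- Two representations are the same iff their multisets of summands coincide.
  SameRep : ∀ {h A b} → Rep h A b → Rep h A b → Set
  SameRep r r' = toList (proj₁ r) ↭ toList (proj₁ r')

  -- "There are at most g distinct representations of b": among any g+1
  -- representations, two (with different indices) are the same.
  AtMostReps : (g h : ℕ) → Pred Carrier 0ℓ → Carrier → Set
  AtMostReps g h A b =
    (r : Fin (sucℕ g) → Rep h A b) →
    Σ (Fin (sucℕ g)) λ i → Σ (Fin (sucℕ g)) λ j → ¬ (i ≡ j) × SameRep (r i) (r j)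

  BhIn : (H : Pred Carrier 0ℓ) → (h g : ℕ) → Pred Carrier 0ℓ → Set
  BhIn H h g A = (b : Carrier) → H b → AtMostReps g h A b

  Bh : (h g : ℕ) → Pred Carrier 0ℓ → Set
  Bh h g A = (b : Carrier) → AtMostReps g h A b

module _ (G G' : FinAbGroup) (φ : Car G → Car G') where
  private
    module G  = FinAbGroup G
    module G' = FinAbGroup G'

  IsHom : Set
  IsHom = ∀ x y → φ (x G.+ y) ≡ φ x G'.+ φ y

  Ker : Set
  Ker = Σ G.Carrier λ x → φ x ≡ G'.0#

  KerCard : ℕ → Set
  KerCard g₁ = Ker ↔ Fin g₁

  ImG : Pred G'.Carrier 0ℓ
  ImG y = ∃ λ x → φ x ≡ y

  Img : Pred G.Carrier 0ℓ → Pred G'.Carrier 0ℓ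
  Img A y = ∃ λ x → A x × φ x ≡ y

-- Lift g·g₁ + 1 representations of b′ ∈ φ(G) through φ to representations
-- in A. Their sums all lie in the fibre of φ over b′, a coset of Ker φ with
-- g₁ elements, so by the pigeonhole principle g + 1 of them share the same
-- sum. As A ∈ B_h[g](G), two of these agree as multisets, and applying φ
-- the corresponding representations of b′ agree as well.
module Submission where

open import Defs
open import Data.Nat using (ℕ; suc; _+_; _*_; _≤_; _<_; _<?_)
open import Level using (0ℓ)
open import Relation.Unary using (Pred)
open import Algebra.Bundles using (Group)
import Algebra.Properties.Group as GroupProperties
open import Algebra.Structures using (IsAbelianGroup)
open import Data.Empty using (⊥-elim)
open import Data.Fin using (Fin; zero; suc; inject≤)
open import Data.Fin.Properties using (inject≤-injective; _≟_)
open import Data.List as List using (List; []; _∷_; length; filter; lookup; allFin)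
open import Data.List.Membership.Propositional using (_∈_)
open import Data.List.Membership.Propositional.Properties using (∈-allFin; ∈-lookup)
open import Data.List.Properties using (length-tabulate)
open import Data.List.Relation.Binary.Permutation.Propositional using (_↭_)
open import Data.List.Relation.Binary.Permutation.Propositional.Properties using (map⁺)
open import Data.List.Relation.Unary.All as All using (All; _∷_)
open import Data.List.Relation.Unary.All.Properties using (all-filter; filter⁺)
open import Data.List.Relation.Unary.AllPairs using (_∷_)
open import Data.List.Relation.Unary.Any using (here; there)
open import Data.List.Relation.Unary.Unique.Propositional using (Unique)
import Data.List.Relation.Unary.Unique.Propositional.Properties as Unique
open import Data.Nat.Properties
  using (+-suc; *-suc; ≮⇒≥; +-cancelˡ-≤; +-monoˡ-≤; n<1+n; module ≤-Reasoning)
open import Data.Product using (∃; ∃₂; _×_; _,_; proj₁; proj₂)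
open import Data.Vec using (Vec; []; _∷_; toList; map)
open import Data.Vec.Properties using (toList-map)
import Data.Vec.Relation.Unary.All as VAll
open import Function using (_∘_)
open import Function.Bundles using (Inverse; Injection)
open import Function.Properties.Inverse using (↔⇒↣)
open import Function.Definitions using (Injective)
open import Relation.Binary.Definitions using (DecidableEquality)
open import Relation.Binary.PropositionalEquality
open import Relation.Nullary using (¬_; yes; no; ¬?)

lookup-injective : {X : Set} {xs : List X} → Unique xs →
                   ∀ i j → lookup xs i ≡ lookup xs j → i ≡ j
lookup-injective (_  ∷ _) zero    zero    _  = refl
lookup-injective (x∉ ∷ _) zero    (suc j) eq = ⊥-elim (All.lookup x∉ (∈-lookup j) eq)
lookup-injective (x∉ ∷ _) (suc i) zero    eq = ⊥-elim (All.lookup x∉ (∈-lookup i) (sym eq))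
lookup-injective (_  ∷ u) (suc i) (suc j) eq = cong suc (lookup-injective u i j eq)

a≤g∧g*[1+n]<a+b⇒g*n<b : ∀ g n a b → a ≤ g → g * suc n < a + b → g * n < b
a≤g∧g*[1+n]<a+b⇒g*n<b g n a b a≤g lt = +-cancelˡ-≤ g _ _ (begin
  g + suc (g * n) ≡⟨ +-suc g (g * n) ⟩
  suc (g + g * n) ≡⟨ cong suc (sym (*-suc g n)) ⟩
  suc (g * suc n) ≤⟨ lt ⟩
  a + b           ≤⟨ +-monoˡ-≤ b a≤g ⟩
  g + b           ∎)
  where open ≤-Reasoning

module _ {X B : Set} (_≟B_ : DecidableEquality B) (f : X → B) where

  fibre : B → List X → List X
  fibre c = filter (λ x → f x ≟B c)

  outside : B → List X → List X
  outside c = filter (λ x → ¬? (f x ≟B c))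

  length-fibre+outside : ∀ c xs → length (fibre c xs) + length (outside c xs) ≡ length xs
  length-fibre+outside c [] = refl
  length-fibre+outside c (x ∷ xs) with f x ≟B c
  ... | yes _ = cong suc (length-fibre+outside c xs)
  ... | no  _ = trans (+-suc _ _) (cong suc (length-fibre+outside c xs))

  outside-avoids : ∀ c cs xs → All (λ x → f x ∈ c ∷ cs) xs → All (λ x → f x ∈ cs) (outside c xs)
  outside-avoids c cs xs in-c∷cs = All.map drop-c (All.zip (filter⁺ _ in-c∷cs , all-filter _ xs))
    where
    drop-c : ∀ {x} → f x ∈ c ∷ cs × ¬ f x ≡ c → f x ∈ cs
    drop-c (here fx≡c , fx≢c) = ⊥-elim (fx≢c fx≡c)
    drop-c (there fx∈cs , _)  = fx∈cs

  large-fibre : ∀ g cs xs → Unique xs → All (λ x → f x ∈ cs) xs → g * length cs < length xs →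
    ∃₂ λ c ys → Unique ys × All (λ y → f y ≡ c) ys × g < length ys
  large-fibre g []       []      _ _          ()
  large-fibre g []       (_ ∷ _) _ (() ∷ _)   _
  large-fibre g (c ∷ cs) xs u in-cs lt with g <? length (fibre c xs)
  ... | yes g<fibre = c , fibre c xs , Unique.filter⁺ _ u , all-filter _ xs , g<fibre
  ... | no  g≮fibre = large-fibre g cs (outside c xs) (Unique.filter⁺ _ u) (outside-avoids c cs xs in-cs)
    (a≤g∧g*[1+n]<a+b⇒g*n<b g (length cs) _ _ (≮⇒≥ g≮fibre)
      (subst (g * suc (length cs) <_) (sym (length-fibre+outside c xs)) lt))

pigeonhole-fibre : ∀ {m n} g (f : Fin m → Fin n) → g * n < m →
  ∃₂ λ c (e : Fin (suc g) → Fin m) → Injective _≡_ _≡_ e × (∀ k → f (e k) ≡ c)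
pigeonhole-fibre {m} {n} g f g*n<m
  with c , ys , ys-unique , ys⊆fibre , g<|ys|
    ← large-fibre _≟_ f g (allFin n) (allFin m) (Unique.allFin⁺ m)
        (All.universal (∈-allFin ∘ f) _)
        (subst₂ (λ a b → g * a < b) (sym (length-tabulate _)) (sym (length-tabulate _)) g*n<m)
  = c , e , e-injective , (λ k → All.lookup ys⊆fibre (∈-lookup (inject≤ k g<|ys|)))
  where
  e : Fin (suc g) → Fin m
  e k = lookup ys (inject≤ k g<|ys|)

  e-injective : Injective _≡_ _≡_ e
  e-injective = inject≤-injective _ _ _ _ ∘ lookup-injective ys-unique _ _

preimage-vec : {X Y : Set} {P : X → Set} (φ : X → Y) {n : ℕ} (v : Vec Y n) →
  VAll.All (λ y → ∃ λ x → P x × φ x ≡ y) v → ∃ λ u → VAll.All P u × map φ u ≡ v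
preimage-vec φ []      VAll.[] = [] , VAll.[] , refl
preimage-vec φ (y ∷ v) ((x , Px , φx≡y) VAll.∷ pre)
  with u , Pu , φu≡v ← preimage-vec φ v pre
  = x ∷ u , Px VAll.∷ Pu , cong₂ _∷_ φx≡y φu≡v

group : FinAbGroup → Group 0ℓ 0ℓ
group G = record { isGroup = IsAbelianGroup.isGroup (FinAbGroup.isAbelianGroup G) }

module Homomorphism (G G' : FinAbGroup) (φ : Car G → Car G') (φ-hom : IsHom G G' φ) where
  private
    module G  = Group (group G)
    module G' = Group (group G')
    open GroupProperties (group G) using (//-rightDividesˡ; ∙-cancelʳ)
    open GroupProperties (group G') using (identityˡ-unique)

  hom-ε : φ G.ε ≡ G'.ε
  hom-ε = identityˡ-unique (φ G.ε) (φ G.ε)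
    (trans (sym (φ-hom G.ε G.ε)) (cong φ (G.identityˡ G.ε)))

  hom-sumV : ∀ {n} (u : Vec (Car G) n) → φ (sumV G u) ≡ sumV G' (map φ u)
  hom-sumV []      = hom-ε
  hom-sumV (x ∷ u) = trans (φ-hom x (sumV G u)) (cong (φ x G'.∙_) (hom-sumV u))

  fibre→Ker : ∀ x₀ {x} → φ x ≡ φ x₀ → Ker G G' φ
  fibre→Ker x₀ {x} φx≡φx₀ = x G.// x₀ , identityˡ-unique (φ (x G.// x₀)) (φ x₀) (begin
    φ (x G.// x₀) G'.∙ φ x₀ ≡⟨ φ-hom (x G.// x₀) x₀ ⟨
    φ ((x G.// x₀) G.∙ x₀)  ≡⟨ cong φ (//-rightDividesˡ x₀ x) ⟩
    φ x                     ≡⟨ φx≡φx₀ ⟩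
    φ x₀                    ∎)
    where open ≡-Reasoning

  fibre→Ker-injective : ∀ x₀ {x y} (p : φ x ≡ φ x₀) (q : φ y ≡ φ x₀) →
                        fibre→Ker x₀ p ≡ fibre→Ker x₀ q → x ≡ y
  fibre→Ker-injective x₀ {x} {y} _ _ eq = ∙-cancelʳ (x₀ G.⁻¹) x y (cong proj₁ eq)

  module _ {h : ℕ} {A : Pred (Car G) 0ℓ} {b′ : Car G'} (r : Rep G' h (Img G G' φ A) b′) where
    private
      preimage : ∃ λ u → VAll.All A u × map φ u ≡ proj₁ r
      preimage = preimage-vec φ (proj₁ r) (proj₁ (proj₂ r))

    lift : Vec (Car G) h
    lift = proj₁ preimage

    lift-∈ : VAll.All A lift
    lift-∈ = proj₁ (proj₂ preimage)

    map-lift : map φ lift ≡ proj₁ r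
    map-lift = proj₂ (proj₂ preimage)

    hom-sum-lift : φ (sumV G lift) ≡ b′
    hom-sum-lift = begin
      φ (sumV G lift)       ≡⟨ hom-sumV lift ⟩
      sumV G' (map φ lift)  ≡⟨ cong (sumV G') map-lift ⟩
      sumV G' (proj₁ r)     ≡⟨ proj₂ (proj₂ r) ⟩
      b′                    ∎
      where open ≡-Reasoning

  lift-↭ : ∀ {h A b′} (r s : Rep G' h (Img G G' φ A) b′) →
           toList (lift r) ↭ toList (lift s) → SameRep G' r s
  lift-↭ r s = subst₂ _↭_ (toList-lift r) (toList-lift s) ∘ map⁺ φ
    where
    toList-lift : ∀ {h A b′} (r : Rep G' h (Img G G' φ A) b′) →
                  List.map φ (toList (lift r)) ≡ toList (proj₁ r)
    toList-lift r = trans (sym (toList-map φ (lift r))) (cong toList (map-lift r))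

lemma2p1 : (G G' : FinAbGroup) (h g g₁ : ℕ) → 2 ≤ h → 1 ≤ g →
    (φ : Car G → Car G') → IsHom G G' φ → KerCard G G' φ g₁ →
    (A : Pred (Car G) 0ℓ) → Bh G h g A →
    BhIn G' (ImG G G' φ) h (g * g₁) (Img G G' φ A)
lemma2p1 G G' h g g₁ _ _ φ φ-hom ker A A∈Bh b′ (x₀ , φx₀≡b′) r =
  let c , e , e-injective , offset-e≡c = pigeonhole-fibre g offset (n<1+n (g * g₁))
      same-sum k = sum-injective (e k) (e zero) (trans (offset-e≡c k) (sym (offset-e≡c zero)))
      i , j , i≢j , uᵢ↭uⱼ = A∈Bh (sumV G (u (e zero))) (λ k → u (e k) , lift-∈ (r (e k)) , same-sum k)
  in e i , e j , i≢j ∘ e-injective , lift-↭ (r (e i)) (r (e j)) uᵢ↭uⱼ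
  where
  open Homomorphism G G' φ φ-hom

  u : Fin (suc (g * g₁)) → Vec (Car G) h
  u k = lift (r k)

  sum-in-fibre : ∀ k → φ (sumV G (u k)) ≡ φ x₀
  sum-in-fibre k = trans (hom-sum-lift (r k)) (sym φx₀≡b′)

  offset : Fin (suc (g * g₁)) → Fin g₁
  offset k = Inverse.to ker (fibre→Ker x₀ (sum-in-fibre k))

  sum-injective : ∀ k l → offset k ≡ offset l → sumV G (u k) ≡ sumV G (u l)
  sum-injective k l = fibre→Ker-injective x₀ _ _ ∘ Injection.injective (↔⇒↣ ker)
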